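{- Every bi-nut digraph is strongly connected.
   Context: A digraph $G$ is a finite nonempty vertex set $V(G)$ with an arbitrary binary relation $\to$. $\operatorname{Ker}G=\{\mathbf{x}\colon V(G)\to\mathbb{R} : \sum_{u: v\to u}\mathbf{x}(u)=0\ \forall v\}$ and $\operatorname{CoKer}G=\{\mathbf{x} : \sum_{u: u\to v}\mathbf{x}(u)=0\ \forall v\}$ (kernels of the adjacency matrix and its transpose). A vector is full if it has no zero entry. $G$ is bi-nut if both $\operatorname{Ker}G$ and $\operatorname{CoKer}G$ are one-dimensional and each is spanned by a full vector. $G$ is strongly connected if for every ordered pair of vertices there is a directed path from the first to the second.
   Formalization: The vectors of $\operatorname{Ker}G$ and $\operatorname{CoKer}G$ in the bi-nut condition, and the scalars spanning them, are taken over ℚ instead of ℝ. -}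

module Defs where

open import Data.Nat using (ℕ; zero; suc)
open import Data.Fin using (Fin; zero; suc)
open import Data.Bool using (Bool; true; false; T; if_then_else_)
open import Data.Rational using (ℚ; 0ℚ; _+_; _*_)
open import Data.Product using (Σ; _×_; _,_)
open import Relation.Binary.PropositionalEquality using (_≡_)
open import Relation.Binary.Construct.Closure.ReflexiveTransitive using (Star)
open import Relation.Nullary using (¬_)

record Digraph : Set where
  field
    m   : ℕ
    adj : Fin (suc m) → Fin (suc m) → Bool

  Vertex : Set
  Vertex = Fin (suc m)

  _⇒_ : Vertex → Vertex → Set
  u ⇒ v = T (adj u v)

open Digraph public

sumFin : (n : ℕ) → (Fin n → ℚ) → ℚ
sumFin zero    f = 0ℚ
sumFin (suc n) f = f zero + sumFin n (λ i → f (suc i))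

InKer : (G : Digraph) → (Vertex G → ℚ) → Set
InKer G x = ∀ v → sumFin (suc (m G)) (λ u → if adj G v u then x u else 0ℚ) ≡ 0ℚ

InCoKer : (G : Digraph) → (Vertex G → ℚ) → Set
InCoKer G x = ∀ v → sumFin (suc (m G)) (λ u → if adj G u v then x u else 0ℚ) ≡ 0ℚ

Full : {A : Set} → (A → ℚ) → Set
Full x = ∀ u → ¬ (x u ≡ 0ℚ)

-- the subspace S is one-dimensional and spanned by a full vector:
-- S = span{x} for some full x (x ≠ 0 as the vertex set is nonempty)
SpannedByFull : {A : Set} → ((A → ℚ) → Set) → Set
SpannedByFull {A} S =
  Σ (A → ℚ) λ x → Full x × S x × (∀ y → S y → Σ ℚ λ c → ∀ u → y u ≡ c * x u)

BiNut : Digraph → Set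
BiNut G = SpannedByFull (InKer G) × SpannedByFull (InCoKer G)

Reach : (G : Digraph) → Vertex G → Vertex G → Set
Reach G = Star (_⇒_ G)

StronglyConnected : Digraph → Set
StronglyConnected G = ∀ u v → Reach G u v

{-# OPTIONS --safe #-}

-- Suppose v is not reachable from u. The vertices reachable from u form a set P that no
-- edge leaves, so the adjacency matrix A is block triangular: A restricted to P × ¬P is 0.
-- Restricted to ¬P, the full cokernel vector y is then a nonzero left null vector of the
-- diagonal block of A on ¬P; that block is therefore singular, and a nonzero right null
-- vector of it, extended by zero on P, lies in Ker A. But Ker A is spanned by a full vector,
-- so a kernel vector vanishing at u vanishes everywhere. Since reachability in a finite
-- digraph is decidable, this contradiction produces a path from u to v.
module Submission where

open import Defs

open import Algebra.Bundles using (CommutativeRing)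
open import Data.Bool.Base using (true; false; if_then_else_; T)
open import Data.Fin.Base using (Fin; zero; suc; punchIn; punchOut)
open import Data.Fin.Properties using (punchIn-punchOut; punchInᵢ≢i; any?) renaming (_≟_ to _≟ᶠ_)
open import Data.Fin.Subset using (Subset; _∈_; _∉_; _⊂_; _⊃_; _∪_; ⁅_⁆)
open import Data.Fin.Subset.Induction using (Acc; acc; ⊃-wellFounded)
open import Data.Fin.Subset.Properties
  using (_∈?_; x∈⁅x⁆; x∈⁅y⁆⇒x≡y; p⊆p∪q; q⊆p∪q; x∈p∪q⁻)
open import Data.Nat.Base using (ℕ; zero; suc; _<_; s≤s)
open import Data.Nat.Properties using (n<1+n)
open import Data.Product using (∃-syntax; _×_; _,_)
open import Data.Rational.Base using (ℚ; 0ℚ; 1ℚ; _+_; _*_; -_; 1/_; NonZero; ≢-nonZero)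
import Data.Rational.Properties as ℚ
open import Data.Rational.Solver using (module +-*-Solver)
open import Data.Sum using (_⊎_; inj₁; inj₂)
open import Data.Unit.Base using (tt)
open import Data.Vec.Functional using (Vector; _∷_; removeAt)
open import Function.Base using (_∘_; id; case_of_)
open import Level using (0ℓ)
open import Relation.Binary.Construct.Closure.ReflexiveTransitive using (Star; ε; _◅◅_; return; fold)
open import Relation.Binary.Core using (Rel)
import Relation.Binary.Definitions as B
open import Relation.Binary.Definitions using (_Respects_)
open import Relation.Binary.PropositionalEquality
open import Relation.Nullary using (¬_; yes; no; ¬?; does; contradiction)
open import Relation.Nullary.Decidable using (decidable-stable; dec-true; dec-false; map′; _×-dec_; T?)
open import Relation.Unary using (Pred; Decidable)

open import Algebra.Apartness.Properties.HeytingCommutativeRing ℚ.heytingCommutativeRing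
  using (x#0y#0→xy#0)
open import Algebra.Properties.Semiring.Sum (CommutativeRing.semiring ℚ.+-*-commutativeRing)
  using ( sum; sum-cong-≗; sum-replicate-zero; sum-remove
        ; ∑-comm; ∑-distrib-+; *-distribˡ-sum; *-distribʳ-sum)

open +-*-Solver using (solve; _:+_; _:*_; :-_; _:=_; con)
open ≡-Reasoning

private
  variable
    r n : ℕ

x*y≡0⇒y≡0 : ∀ {x y} → x ≢ 0ℚ → x * y ≡ 0ℚ → y ≡ 0ℚ
x*y≡0⇒y≡0 {y = y} x≢0 xy≡0 =
  decidable-stable (y ℚ.≟ 0ℚ) (λ y≢0 → x#0y#0→xy#0 x≢0 y≢0 xy≡0)

∀-punchIn : ∀ {p} (P : Pred (Fin (suc n)) p) i → P i → (∀ j → P (punchIn i j)) → ∀ a → P a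
∀-punchIn P i Pi P-punchIn a with i ≟ᶠ a
... | yes refl = Pi
... | no i≢a   = subst P (punchIn-punchOut i≢a) (P-punchIn (punchOut i≢a))

Matrix : ℕ → ℕ → Set
Matrix r n = Fin r → Fin n → ℚ

infix 8 _·_
infixl 7 _*ᵥ_ _ᵥ*_

_·_ : Vector ℚ n → Vector ℚ n → ℚ
x · y = sum (λ i → x i * y i)

_*ᵥ_ : Matrix r n → Vector ℚ n → Vector ℚ r
(M *ᵥ z) a = M a · z

_ᵥ*_ : Vector ℚ r → Matrix r n → Vector ℚ n
(w ᵥ* M) c = w · (λ a → M a c)

IsZero : Vector ℚ n → Set
IsZero x = ∀ i → x i ≡ 0ℚ

Nonzero : Vector ℚ n → Set
Nonzero x = ∃[ i ] x i ≢ 0ℚ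

sum-zero : {f : Vector ℚ n} → IsZero f → sum f ≡ 0ℚ
sum-zero {n} f≡0 = trans (sum-cong-≗ f≡0) (sum-replicate-zero n)

·-zeroˡ : {x : Vector ℚ n} → IsZero x → ∀ y → x · y ≡ 0ℚ
·-zeroˡ x≡0 y = sum-zero (λ i → trans (cong (_* y i) (x≡0 i)) (ℚ.*-zeroˡ (y i)))

·-zeroʳ : ∀ (x : Vector ℚ n) {y} → IsZero y → x · y ≡ 0ℚ
·-zeroʳ x y≡0 = sum-zero (λ i → trans (cong (x i *_) (y≡0 i)) (ℚ.*-zeroʳ (x i)))

·-linearˡ : ∀ k (x y z : Vector ℚ n) → (λ c → x c + k * y c) · z ≡ x · z + k * (y · z)
·-linearˡ k x y z = begin
  sum (λ c → (x c + k * y c) * z c)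
    ≡⟨ sum-cong-≗ (λ c → distrib (x c) k (y c) (z c)) ⟩
  sum (λ c → x c * z c + k * (y c * z c))
    ≡⟨ ∑-distrib-+ (λ c → x c * z c) (λ c → k * (y c * z c)) ⟩
  x · z + sum (λ c → k * (y c * z c))
    ≡⟨ cong (x · z +_) (*-distribˡ-sum k (λ c → y c * z c)) ⟨
  x · z + k * (y · z)
    ∎
  where
  distrib : ∀ x k y z → (x + k * y) * z ≡ x * z + k * (y * z)
  distrib = solve 4 (λ x k y z → (x :+ k :* y) :* z := x :* z :+ k :* (y :* z)) refl

·-*ᵥ-assoc : ∀ (w : Vector ℚ r) (M : Matrix r n) z → w · (M *ᵥ z) ≡ (w ᵥ* M) · z
·-*ᵥ-assoc w M z = begin
  sum (λ a → w a * sum (λ c → M a c * z c))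
    ≡⟨ sum-cong-≗ (λ a → *-distribˡ-sum (w a) (λ c → M a c * z c)) ⟩
  sum (λ a → sum (λ c → w a * (M a c * z c)))
    ≡⟨ ∑-comm (λ a c → w a * (M a c * z c)) ⟩
  sum (λ c → sum (λ a → w a * (M a c * z c)))
    ≡⟨ sum-cong-≗ (λ c → sum-cong-≗ (λ a → ℚ.*-assoc (w a) (M a c) (z c))) ⟨
  sum (λ c → sum (λ a → w a * M a c * z c))
    ≡⟨ sum-cong-≗ (λ c → *-distribʳ-sum (z c) (λ a → w a * M a c)) ⟨
  sum (λ c → sum (λ a → w a * M a c) * z c)
    ∎

module GaussianElimination
  (M : Matrix (suc r) (suc n)) (p : Fin (suc r)) (pivot≢0 : M p zero ≢ 0ℚ) where

  private
    instance
      pivot-nonZero : NonZero (M p zero)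
      pivot-nonZero = ≢-nonZero pivot≢0

    pivot⁻¹ : ℚ
    pivot⁻¹ = 1/ M p zero

  reduced : Matrix r n
  reduced j c = M (punchIn p j) (suc c) + - (M (punchIn p j) zero * pivot⁻¹) * M p (suc c)

  backSubstitute : Vector ℚ n → Vector ℚ (suc n)
  backSubstitute z = - (((M p ∘ suc) · z) * pivot⁻¹) ∷ z

  backSubstitute-kernel : ∀ {z} → IsZero (reduced *ᵥ z) → IsZero (M *ᵥ backSubstitute z)
  backSubstitute-kernel {z} reduced-z≡0 =
    ∀-punchIn (λ a → (M *ᵥ backSubstitute z) a ≡ 0ℚ) p pivot-row other-row
    where
    s : ℚ
    s = (M p ∘ suc) · z

    pivot-row : (M *ᵥ backSubstitute z) p ≡ 0ℚ
    pivot-row = begin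
      M p zero * - (s * pivot⁻¹) + s    ≡⟨ rearrange (M p zero) s pivot⁻¹ ⟩
      s + - (s * (M p zero * pivot⁻¹))  ≡⟨ cong (λ t → s + - (s * t)) (ℚ.*-inverseʳ (M p zero)) ⟩
      s + - (s * 1ℚ)                    ≡⟨ cancel s ⟩
      0ℚ                                ∎
      where
      rearrange : ∀ a s b → a * - (s * b) + s ≡ s + - (s * (a * b))
      rearrange = solve 3 (λ a s b → a :* (:- (s :* b)) :+ s := s :+ (:- (s :* (a :* b)))) refl
      cancel : ∀ s → s + - (s * 1ℚ) ≡ 0ℚ
      cancel = solve 1 (λ s → s :+ (:- (s :* con 1ℚ)) := con 0ℚ) refl

    other-row : ∀ j → (M *ᵥ backSubstitute z) (punchIn p j) ≡ 0ℚ
    other-row j = begin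
      m₀ * - (s * pivot⁻¹) + (Mⱼ ∘ suc) · z  ≡⟨ rearrange m₀ s pivot⁻¹ ((Mⱼ ∘ suc) · z) ⟩
      (Mⱼ ∘ suc) · z + - (m₀ * pivot⁻¹) * s  ≡⟨ ·-linearˡ (- (m₀ * pivot⁻¹)) (Mⱼ ∘ suc) (M p ∘ suc) z ⟨
      reduced j · z                          ≡⟨ reduced-z≡0 j ⟩
      0ℚ                                     ∎
      where
      Mⱼ : Vector ℚ (suc n)
      Mⱼ = M (punchIn p j)
      m₀ : ℚ
      m₀ = Mⱼ zero
      rearrange : ∀ m s b t → m * - (s * b) + t ≡ t + - (m * b) * s
      rearrange = solve 4 (λ m s b t → m :* (:- (s :* b)) :+ t := t :+ (:- (m :* b)) :* s) refl

zeroColumn-kernel : (M : Matrix r (suc n)) → IsZero (λ a → M a zero) →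
                    IsZero (M *ᵥ (1ℚ ∷ λ _ → 0ℚ))
zeroColumn-kernel M column≡0 a = begin
  M a zero * 1ℚ + (M a ∘ suc) · (λ _ → 0ℚ)  ≡⟨ cong₂ _+_ Mₐ₀*1≡0 (·-zeroʳ (M a ∘ suc) (λ _ → refl)) ⟩
  0ℚ + 0ℚ                                   ≡⟨ ℚ.+-identityˡ 0ℚ ⟩
  0ℚ                                        ∎
  where
  Mₐ₀*1≡0 : M a zero * 1ℚ ≡ 0ℚ
  Mₐ₀*1≡0 = trans (ℚ.*-identityʳ (M a zero)) (column≡0 a)

underdetermined-kernel : r < n → (M : Matrix r n) → ∃[ z ] Nonzero z × IsZero (M *ᵥ z)
underdetermined-kernel {zero}  {suc n} _          M = (λ _ → 1ℚ) , (zero , λ ()) , λ ()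
underdetermined-kernel {suc r} {suc n} (s≤s r<n) M with any? (λ p → ¬? (M p zero ℚ.≟ 0ℚ))
... | no no-pivot = (1ℚ ∷ λ _ → 0ℚ) , (zero , λ ()) , zeroColumn-kernel M column≡0
  where
  column≡0 : IsZero (λ p → M p zero)
  column≡0 p = decidable-stable (M p zero ℚ.≟ 0ℚ) (λ pivot≢0 → no-pivot (p , pivot≢0))
... | yes (p , pivot≢0) with underdetermined-kernel r<n (GaussianElimination.reduced M p pivot≢0)
...   | z , (i , zᵢ≢0) , reduced-z≡0 =
  backSubstitute z , (suc i , zᵢ≢0) , backSubstitute-kernel reduced-z≡0
  where open GaussianElimination M p pivot≢0

left-singular⇒right-singular : (M : Matrix n n) {w : Vector ℚ n} → Nonzero w → IsZero (w ᵥ* M) →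
                               ∃[ z ] Nonzero z × IsZero (M *ᵥ z)
left-singular⇒right-singular {suc n} M {w} (i , wᵢ≢0) wM≡0
  with underdetermined-kernel (n<1+n n) (removeAt M i)
... | z , z≢0 , Mz≡0 = z , z≢0 , ∀-punchIn (λ a → (M *ᵥ z) a ≡ 0ℚ) i row-i Mz≡0
  where
  row-i : (M *ᵥ z) i ≡ 0ℚ
  row-i = x*y≡0⇒y≡0 wᵢ≢0 (begin
    w i * (M *ᵥ z) i
      ≡⟨ ℚ.+-identityʳ _ ⟨
    w i * (M *ᵥ z) i + 0ℚ
      ≡⟨ cong (w i * (M *ᵥ z) i +_) (·-zeroʳ (removeAt w i) Mz≡0) ⟨
    w i * (M *ᵥ z) i + removeAt w i · removeAt (M *ᵥ z) i
      ≡⟨ sum-remove (λ a → w a * (M *ᵥ z) a) ⟨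
    w · (M *ᵥ z)
      ≡⟨ ·-*ᵥ-assoc w M z ⟩
    (w ᵥ* M) · z
      ≡⟨ ·-zeroˡ wM≡0 z ⟩
    0ℚ
      ∎)

I : Matrix n n
I a b = if does (a ≟ᶠ b) then 1ℚ else 0ℚ

*ᵥ-identityˡ : ∀ (z : Vector ℚ n) a → (I *ᵥ z) a ≡ z a
*ᵥ-identityˡ {suc n} z a = begin
  I a · z                                        ≡⟨ sum-remove (λ b → I a b * z b) ⟩
  I a a * z a + removeAt (I a) a · removeAt z a  ≡⟨ cong₂ _+_ diagonal (·-zeroˡ off-diagonal (removeAt z a)) ⟩
  1ℚ * z a + 0ℚ                                  ≡⟨ trans (ℚ.+-identityʳ _) (ℚ.*-identityˡ (z a)) ⟩
  z a                                            ∎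
  where
  diagonal : I a a * z a ≡ 1ℚ * z a
  diagonal = cong (λ t → (if t then 1ℚ else 0ℚ) * z a) (dec-true (a ≟ᶠ a) refl)

  off-diagonal : IsZero (removeAt (I a) a)
  off-diagonal j =
    cong (if_then 1ℚ else 0ℚ) (dec-false (a ≟ᶠ punchIn a j) (punchInᵢ≢i a j ∘ sym))

VanishesOn : ∀ {p} → Pred (Fin n) p → Vector ℚ n → Set p
VanishesOn P z = ∀ {a} → P a → z a ≡ 0ℚ

module BlockTriangular {p} {P : Pred (Fin n) p} (P? : Decidable P) (A : Matrix n n)
                       (no-exit : ∀ {a b} → P a → ¬ P b → A a b ≡ 0ℚ) where

  -- M = diag(I, A on ¬P × ¬P): a square matrix standing in for the block A on ¬P × ¬P,
  -- so that no reindexing of ¬P by some Fin k is needed.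
  M : Matrix n n
  M a b = if does (P? a) then I a b else if does (P? b) then 0ℚ else A a b

  mask : Vector ℚ n → Vector ℚ n
  mask y a = if does (P? a) then 0ℚ else y a

  private
    M-inside : ∀ {a} → P a → ∀ b → M a b ≡ I a b
    M-inside {a} Pa b =
      cong (if_then I a b else if does (P? b) then 0ℚ else A a b) (dec-true (P? a) Pa)

    mask-outside : ∀ y {a} → ¬ P a → mask y a ≡ y a
    mask-outside y {a} ¬Pa = cong (if_then 0ℚ else y a) (dec-false (P? a) ¬Pa)

    mask-M-inside : ∀ y a {b} → P b → mask y a * M a b ≡ 0ℚ
    mask-M-inside y a {b} Pb with P? a | P? b
    ... | yes _ | _      = ℚ.*-zeroˡ (I a b)
    ... | no _  | yes _  = ℚ.*-zeroʳ (y a)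
    ... | no _  | no ¬Pb = contradiction Pb ¬Pb

    mask-M-outside : ∀ y a {b} → ¬ P b → mask y a * M a b ≡ y a * A a b
    mask-M-outside y a {b} ¬Pb with P? a | P? b
    ... | _      | yes Pb = contradiction Pb ¬Pb
    ... | yes Pa | no _   = begin
      0ℚ * I a _     ≡⟨ ℚ.*-zeroˡ (I a _) ⟩
      0ℚ             ≡⟨ ℚ.*-zeroʳ (y a) ⟨
      y a * 0ℚ       ≡⟨ cong (y a *_) (no-exit Pa ¬Pb) ⟨
      y a * A a _    ∎
    ... | no _   | no _   = refl

    A-inside : ∀ {z} → VanishesOn P z → ∀ {a} → P a → ∀ b → A a b * z b ≡ 0ℚ
    A-inside {z} z-vanishes Pa b with P? b
    ... | yes Pb  = trans (cong (A _ b *_) (z-vanishes Pb)) (ℚ.*-zeroʳ (A _ b))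
    ... | no ¬Pb  = trans (cong (_* z b) (no-exit Pa ¬Pb)) (ℚ.*-zeroˡ (z b))

    A-outside : ∀ {z} → VanishesOn P z → ∀ {a} → ¬ P a → ∀ b → A a b * z b ≡ M a b * z b
    A-outside {z} z-vanishes {a} ¬Pa b with P? a | P? b
    ... | yes Pa | _      = contradiction Pa ¬Pa
    ... | no _   | yes Pb = begin
      A a b * z b   ≡⟨ cong (A a b *_) (z-vanishes Pb) ⟩
      A a b * 0ℚ    ≡⟨ ℚ.*-zeroʳ (A a b) ⟩
      0ℚ            ≡⟨ ℚ.*-zeroˡ 0ℚ ⟨
      0ℚ * 0ℚ       ≡⟨ cong (0ℚ *_) (z-vanishes Pb) ⟨
      0ℚ * z b      ∎
    ... | no _   | no _   = refl

  mask-ᵥ* : ∀ {y} → IsZero (y ᵥ* A) → IsZero (mask y ᵥ* M)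
  -- A `with P? b` would also rewrite P? b inside M and no longer match the lemmas above.
  mask-ᵥ* {y} yA≡0 b = case P? b of λ where
    (yes Pb) → sum-zero (λ a → mask-M-inside y a Pb)
    (no ¬Pb) → trans (sum-cong-≗ (λ a → mask-M-outside y a ¬Pb)) (yA≡0 b)

  M-kernel-vanishes : ∀ {z} → IsZero (M *ᵥ z) → VanishesOn P z
  M-kernel-vanishes {z} Mz≡0 {a} Pa = begin
    z a      ≡⟨ *ᵥ-identityˡ z a ⟨
    I a · z  ≡⟨ sum-cong-≗ (λ b → cong (_* z b) (M-inside Pa b)) ⟨
    M a · z  ≡⟨ Mz≡0 a ⟩
    0ℚ       ∎

  M-kernel⇒A-kernel : ∀ {z} → IsZero (M *ᵥ z) → IsZero (A *ᵥ z)
  M-kernel⇒A-kernel Mz≡0 a with P? a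
  ... | yes Pa = sum-zero (A-inside (M-kernel-vanishes Mz≡0) Pa)
  ... | no ¬Pa = trans (sum-cong-≗ (A-outside (M-kernel-vanishes Mz≡0) ¬Pa)) (Mz≡0 a)

  kernel-vanishingOn : ∀ {y v} → IsZero (y ᵥ* A) → ¬ P v → y v ≢ 0ℚ →
                       ∃[ z ] Nonzero z × IsZero (A *ᵥ z) × VanishesOn P z
  kernel-vanishingOn {y} {v} yA≡0 ¬Pv yᵥ≢0
    with left-singular⇒right-singular M {mask y}
           (v , yᵥ≢0 ∘ trans (sym (mask-outside y ¬Pv))) (mask-ᵥ* {y} yA≡0)
  ... | z , z≢0 , Mz≡0 = z , z≢0 , M-kernel⇒A-kernel Mz≡0 , M-kernel-vanishes Mz≡0

Star-respects : ∀ {a ℓ p} {A : Set a} {R : Rel A ℓ} {P : Pred A p} →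
                P Respects R → P Respects Star R
Star-respects {P = P} closed = fold (λ a b → P a → P b) (λ r Pb⇒Pc → Pb⇒Pc ∘ closed r) id

module _ {ℓ} {R : Rel (Fin n) ℓ} (R? : B.Decidable R) where

  closed⊎exit : (S : Subset n) → (_∈ S) Respects R ⊎ ∃[ a ] ∃[ b ] a ∈ S × R a b × b ∉ S
  closed⊎exit S with any? (λ a → any? (λ b → a ∈? S ×-dec R? a b ×-dec ¬? (b ∈? S)))
  ... | yes (a , b , a∈S , r , b∉S) = inj₂ (a , b , a∈S , r , b∉S)
  ... | no no-exit = inj₁ λ {a} {b} r a∈S →
    decidable-stable (b ∈? S) (λ b∉S → no-exit (a , b , a∈S , r , b∉S))

  ReachableFrom : Fin n → Subset n → Set ℓ
  ReachableFrom u S = ∀ {v} → v ∈ S → Star R u v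

  closedReachableSet : ∀ u → ∃[ S ] u ∈ S × ReachableFrom u S × (_∈ S) Respects R
  closedReachableSet u = grow ⁅ u ⁆ (⊃-wellFounded ⁅ u ⁆) (x∈⁅x⁆ u) reachable-⁅u⁆
    where
    reachable-⁅u⁆ : ReachableFrom u ⁅ u ⁆
    reachable-⁅u⁆ v∈⁅u⁆ rewrite x∈⁅y⁆⇒x≡y u v∈⁅u⁆ = ε

    grow : ∀ S → Acc _⊃_ S → u ∈ S → ReachableFrom u S →
           ∃[ S ] u ∈ S × ReachableFrom u S × (_∈ S) Respects R
    grow S (acc larger) u∈S reachable with closed⊎exit S
    ... | inj₁ closed = S , u∈S , reachable , closed
    ... | inj₂ (a , b , a∈S , r , b∉S) =
      grow (S ∪ ⁅ b ⁆) (larger S⊂S∪⁅b⁆) (p⊆p∪q ⁅ b ⁆ u∈S) reachable′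
      where
      S⊂S∪⁅b⁆ : S ⊂ S ∪ ⁅ b ⁆
      S⊂S∪⁅b⁆ = p⊆p∪q ⁅ b ⁆ , b , q⊆p∪q S ⁅ b ⁆ (x∈⁅x⁆ b) , b∉S

      reachable′ : ReachableFrom u (S ∪ ⁅ b ⁆)
      reachable′ v∈ with x∈p∪q⁻ S ⁅ b ⁆ v∈
      ... | inj₁ v∈S = reachable v∈S
      ... | inj₂ v∈⁅b⁆ rewrite x∈⁅y⁆⇒x≡y b v∈⁅b⁆ = reachable a∈S ◅◅ return r

  Star? : B.Decidable (Star R)
  Star? u v with closedReachableSet u
  ... | S , u∈S , reachable , closed =
    map′ reachable (λ path → Star-respects closed path u∈S) (v ∈? S)

sumFin≡sum : ∀ n (f : Vector ℚ n) → sumFin n f ≡ sum f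
sumFin≡sum zero    f = refl
sumFin≡sum (suc n) f = cong (f zero +_) (sumFin≡sum n (f ∘ suc))

adjacency : (G : Digraph) → Matrix (suc (m G)) (suc (m G))
adjacency G a b = if adj G a b then 1ℚ else 0ℚ

module _ (G : Digraph) where

  kernel⇒InKer : ∀ {x} → IsZero (adjacency G *ᵥ x) → InKer G x
  kernel⇒InKer {x} Ax≡0 v = begin
    sumFin _ row          ≡⟨ sumFin≡sum _ row ⟩
    sum row               ≡⟨ sum-cong-≗ (λ u → select (adj G v u) (x u)) ⟨
    (adjacency G *ᵥ x) v  ≡⟨ Ax≡0 v ⟩
    0ℚ                    ∎
    where
    row : Vector ℚ (suc (m G))
    row u = if adj G v u then x u else 0ℚ

    select : ∀ e x → (if e then 1ℚ else 0ℚ) * x ≡ (if e then x else 0ℚ)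
    select true  x = ℚ.*-identityˡ x
    select false x = ℚ.*-zeroˡ x

  InCoKer⇒cokernel : ∀ {y} → InCoKer G y → IsZero (y ᵥ* adjacency G)
  InCoKer⇒cokernel {y} y∈CoKer v = begin
    (y ᵥ* adjacency G) v  ≡⟨ sum-cong-≗ (λ u → select (adj G u v) (y u)) ⟩
    sum column            ≡⟨ sumFin≡sum _ column ⟨
    sumFin _ column       ≡⟨ y∈CoKer v ⟩
    0ℚ                    ∎
    where
    column : Vector ℚ (suc (m G))
    column u = if adj G u v then y u else 0ℚ

    select : ∀ e y → y * (if e then 1ℚ else 0ℚ) ≡ (if e then y else 0ℚ)
    select true  y = ℚ.*-identityʳ y
    select false y = ℚ.*-zeroʳ y

  closed⇒no-exit : ∀ {p} {P : Pred (Vertex G) p} → P Respects (_⇒_ G) →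
                   ∀ {a b} → P a → ¬ P b → adjacency G a b ≡ 0ℚ
  closed⇒no-exit closed {a} {b} Pa ¬Pb with adj G a b in a⇒b
  ... | true  = contradiction (closed (subst T (sym a⇒b) tt) Pa) ¬Pb
  ... | false = refl

SpannedByFull-vanishing : ∀ {S : Pred (Vector ℚ n) 0ℓ} → SpannedByFull S →
                          ∀ {z u} → S z → z u ≡ 0ℚ → IsZero z
SpannedByFull-vanishing (x , x-full , _ , x-spans) {z} {u} z∈S zᵤ≡0 i
  with x-spans z z∈S
... | c , z≡cx = begin
  z i      ≡⟨ z≡cx i ⟩
  c * x i  ≡⟨ cong (_* x i) c≡0 ⟩
  0ℚ * x i ≡⟨ ℚ.*-zeroˡ (x i) ⟩
  0ℚ       ∎
  where
  c≡0 : c ≡ 0ℚ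
  c≡0 = x*y≡0⇒y≡0 (x-full u) (trans (ℚ.*-comm (x u) c) (trans (sym (z≡cx u)) zᵤ≡0))

BiNut⇒closed⇒universal : ∀ G → BiNut G → ∀ {p} {P : Pred (Vertex G) p} → Decidable P →
                       P Respects (_⇒_ G) → ∀ {u} → P u → ∀ v → P v
BiNut⇒closed⇒universal G (ker-spanned , (y , y-full , y∈CoKer , _)) P? closed {u} Pu v =
  decidable-stable (P? v) λ ¬Pv →
    let z , (i , zᵢ≢0) , Az≡0 , z-vanishes =
          BlockTriangular.kernel-vanishingOn P? (adjacency G) (closed⇒no-exit G closed) {y}
            (InCoKer⇒cokernel G {y} y∈CoKer) ¬Pv (y-full v)
    in zᵢ≢0 (SpannedByFull-vanishing ker-spanned {z} (kernel⇒InKer G {z} Az≡0) (z-vanishes Pu) i)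

theorem22 : (G : Digraph) → BiNut G → StronglyConnected G
theorem22 G bi-nut u =
  BiNut⇒closed⇒universal G bi-nut (Star? (λ a b → T? (adj G a b)) u)
    (λ edge path → path ◅◅ return edge) ε
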